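{- Let $G$ be a finite partial graph equipped with a local coloring $\mathsf{c}$, and let $P$ be a set of vertex-color pairs of $G$ which dominates cusp-points. If $G$ has no cusp-free cycle, then for every element $(v,\alpha)\in P$ that is maximal in $P$ for the relation $\lhd$ restricted to $P$, the vertex $v$ is splitting.
   Context: A (finite, undirected, multi) partial graph is a triple $(\mathcal V,\mathcal E,\psi)$ of disjoint finite sets of vertices $\mathcal V$ and edges $\mathcal E$ and an incidence function $\psi$ assigning to each edge a set of at most two vertices (its endpoints). A path is a finite alternating sequence $(v_0,e_1,v_1,\dots,e_n,v_n)$ ($n\ge 0$) such that for each $i$ the endpoints of $e_i$ are exactly $v_{i-1}$ and $v_i$, which are distinct. It is simple if its edges are pairwise distinct and its vertices are pairwise distinct except possibly $v_0=v_n$; closed if $v_0=v_n$, open otherwise. A cycle is a simple closed path with at least one edge. A local coloring is a function $\mathsf c$ assigning to each pair $(e,v)$, with $v$ an endpoint of the edge $e$, a color in a finite set $\mathsf C$. A cusp is a triple $(e,v,f)$ of two distinct edges $e,f$ both incident to $v$ with $\mathsf c(e,v)=\mathsf c(f,v)$; its vertex is $v$, its color is this common color $\alpha$, and $(v,\alpha)$ is then called a cusp-point. A vertex-color pair is any element of $\mathcal V\times\mathsf C$. A cusp of a path is a cusp $(e_i,v_i,e_{i+1})$ formed by consecutive elements of the path, or, if the path is closed, the cusp $(e_n,v_0,e_1)$. A path is cusp-free if it has no cusp. For a path with at least one edge, its starting color is $\mathsf c(e_1,v_0)$ and its ending color is $\mathsf c(e_n,v_n)$. A vertex $v$ is splitting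 if every cycle containing $v$ has a cusp at $v$ (i.e., the two edges of the cycle adjacent to $v$ form a cusp). Write $(v,\alpha)\to_p(u,\beta)$ if $p$ is a simple open cusp-free path from $v$ to $u$ whose starting color is not $\alpha$ and whose ending color is $\beta$. Write $(v,\alpha)\lhd(u,\beta)$ if there is such a $p$ with $(v,\alpha)\to_p(u,\beta)$ and, moreover, for every vertex $x$, color $\tau$ and path $q$ with $(u,\beta)\to_q(x,\tau)$, the vertex $x$ does not occur in $p$. A set $P$ of vertex-color pairs dominates cusp-points if for every cusp-point $(v,\alpha)$, either $(v,\alpha)\in P$ or there is $(u,\beta)\in P$ with $(v,\alpha)\lhd(u,\beta)$. -}

module Defs where

open import Data.Nat using (ℕ; zero; suc; _≤_)
open import Data.Fin using (Fin; zero; suc; toℕ; fromℕ; inject₁)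
open import Data.Product using (Σ; _×_; _,_; ∃)
open import Data.Sum using (_⊎_)
open import Data.Empty using (⊥)
open import Relation.Nullary using (¬_)
open import Relation.Binary.PropositionalEquality using (_≡_; _≢_)

data Ends (n : ℕ) : Set where
  none : Ends n
  one  : Fin n → Ends n
  two  : (u v : Fin n) → u ≢ v → Ends n

_∈ₑ_ : ∀ {n} → Fin n → Ends n → Set
w ∈ₑ none      = ⊥
w ∈ₑ one v     = w ≡ v
w ∈ₑ two u v _ = w ≡ u ⊎ w ≡ v

-- The local coloring is given as a total function; only its values on
-- incident pairs (e , v) with v ∈ₑ ψ e are ever used.
record ColGraph : Set where
  field
    n m k : ℕ
    ψ : Fin m → Ends n
    c : Fin m → Fin n → Fin k

module _ (G : ColGraph) where
  open ColGraph G

  Vtx = Fin n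
  Edge = Fin m
  Color = Fin k

  Joins : Edge → Vtx → Vtx → Set
  Joins e u v = u ≢ v × (∀ w → (w ∈ₑ ψ e → (w ≡ u ⊎ w ≡ v)) × ((w ≡ u ⊎ w ≡ v) → w ∈ₑ ψ e))

  record Path : Set where
    field
      len : ℕ
      vs  : Fin (suc len) → Vtx
      es  : Fin len → Edge
      valid : ∀ (i : Fin len) → Joins (es i) (vs (inject₁ i)) (vs (suc i))

  open Path public

  start : Path → Vtx
  start p = vs p zero

  end : Path → Vtx
  end p = vs p (fromℕ (len p))

  Closed : Path → Set
  Closed p = start p ≡ end p

  Open : Path → Set
  Open p = start p ≢ end p

  IsEndIndex : ∀ {ℓ} → Fin (suc ℓ) → Set
  IsEndIndex {ℓ} i = toℕ i ≡ 0 ⊎ toℕ i ≡ ℓ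

  Simple : Path → Set
  Simple p =
    (∀ i j → es p i ≡ es p j → i ≡ j) ×
    (∀ i j → vs p i ≡ vs p j → i ≡ j ⊎ (IsEndIndex {len p} i × IsEndIndex {len p} j))

  Cycle : Path → Set
  Cycle p = Simple p × Closed p × 1 ≤ len p

  Cusp : Edge → Vtx → Edge → Set
  Cusp e v f = e ≢ f × v ∈ₑ ψ e × v ∈ₑ ψ f × c e v ≡ c f v

  CuspPoint : Vtx → Color → Set
  CuspPoint v α = Σ Edge λ e → Σ Edge λ f → Cusp e v f × c e v ≡ α

  data PathCuspAt (p : Path) (x : Vtx) : Set where
    inner : (i j : Fin (len p)) → toℕ j ≡ suc (toℕ i) →
            vs p (suc i) ≡ x → Cusp (es p i) (vs p (suc i)) (es p j) →
            PathCuspAt p x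
    closing : Closed p → (i j : Fin (len p)) → toℕ i ≡ 0 → suc (toℕ j) ≡ len p →
            vs p zero ≡ x → Cusp (es p j) (vs p zero) (es p i) →
            PathCuspAt p x

  HasCusp : Path → Set
  HasCusp p = Σ Vtx (PathCuspAt p)

  CuspFree : Path → Set
  CuspFree p = ¬ HasCusp p

  StartColor : Path → Color → Set
  StartColor p γ = Σ (Fin (len p)) λ i → toℕ i ≡ 0 × c (es p i) (vs p zero) ≡ γ

  EndColor : Path → Color → Set
  EndColor p γ = Σ (Fin (len p)) λ i → suc (toℕ i) ≡ len p × c (es p i) (end p) ≡ γ

  OccursIn : Vtx → Path → Set
  OccursIn x p = Σ (Fin (suc (len p))) λ i → vs p i ≡ x

  Arrow : Vtx → Color → Path → Vtx → Color → Set
  Arrow v α p u β =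
    Simple p × Open p × CuspFree p × start p ≡ v × end p ≡ u ×
    ¬ StartColor p α × EndColor p β

  Lhd : Vtx → Color → Vtx → Color → Set
  Lhd v α u β = Σ Path λ p → Arrow v α p u β ×
    (∀ x τ q → Arrow u β q x τ → ¬ OccursIn x p)

  Splitting : Vtx → Set
  Splitting v = ∀ p → Cycle p → OccursIn v p → PathCuspAt p v

  Dominates : (Vtx → Color → Set) → Set
  Dominates P = ∀ v α → CuspPoint v α →
    P v α ⊎ Σ Vtx λ u → Σ Color λ β → P u β × Lhd v α u β

  MaximalIn : (Vtx → Color → Set) → Vtx → Color → Set
  MaximalIn P v α = P v α × (∀ u β → P u β → ¬ Lhd v α u β)

  NoCuspFreeCycle : Set
  NoCuspFreeCycle = ∀ p → Cycle p → ¬ CuspFree p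

-- Suppose a cycle through v has no cusp at v.  Rotate it to start at v and orient it so that it
-- leaves v in a color other than α.  As no cycle is cusp-free it has a first cusp, at w with
-- color γ say, and the arc from v to w is a cusp-free path witnessing (v,α) → (w,γ).  Now
-- (v,α) ◁ (w,γ) is impossible: (w,γ) is a cusp-point, so by domination and transitivity of ◁
-- it would give (v,α) ◁ (u,β) for some (u,β) ∈ P, contradicting maximality.  Hence some
-- cusp-free path q leaving w in a color other than γ returns to the cycle; let u be its first
-- return.  If u comes after w, replace the arc from w to u by q.  If u comes before w, the arc
-- from u to w closed up by q is a cycle whose only possible cusp is at u, so that cusp exists,
-- and it guarantees that replacing the arc from u to w by q reversed creates no cusp at u.
-- Either way we get a new cycle of the same kind whose part not yet known to be cusp-free is
-- strictly shorter, so the process cannot go on forever.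
module Submission where

open import Defs
open import Data.Fin as Fin using (Fin; zero; suc; toℕ; fromℕ; inject₁; fromℕ<)
open import Data.Fin.Properties using (toℕ-inject₁; toℕ-fromℕ; toℕ-fromℕ<; toℕ-injective; toℕ<n)
open import Data.Nat using (ℕ; zero; suc; _+_; _∸_; _≤_; _<_; z≤n; s≤s; z<s; s≤s⁻¹; _<?_)
open import Data.Nat.Properties
open import Data.Product using (Σ; ∃; _×_; _,_; proj₁; proj₂)
open import Data.Sum using (_⊎_; inj₁; inj₂; [_,_]′)
open import Data.Empty using (⊥; ⊥-elim)
open import Relation.Nullary using (¬_; yes; no)
open import Relation.Nullary.Decidable using (_×-dec_)
open import Relation.Unary using (Decidable)
open import Relation.Binary.Definitions using (tri<; tri≈; tri>)
open import Relation.Binary.PropositionalEquality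

least-below? : (P : ℕ → Set) → Decidable P → ∀ n →
  (∃ λ k → k < n × P k × (∀ j → j < k → ¬ P j)) ⊎ (∀ j → j < n → ¬ P j)
least-below? P P? zero = inj₂ (λ j ())
least-below? P P? (suc n) with least-below? P P? n
... | inj₁ (k , k<n , pk , below) = inj₁ (k , m<n⇒m<1+n k<n , pk , below)
... | inj₂ none-below with P? n
...   | yes pn = inj₁ (n , ≤-refl , pn , none-below)
...   | no ¬pn = inj₂ λ j j<1+n → [ none-below j , (λ { refl → ¬pn }) ]′ (m<1+n⇒m<n∨m≡n j<1+n)

<-or-+ : ∀ l i → i < l ⊎ ∃ λ d → l + d ≡ i
<-or-+ l i with i <? l
... | yes i<l = inj₁ i<l
... | no i≮l = inj₂ (m≤n⇒∃[o]m+o≡n (≮⇒≥ i≮l))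

suc-∸1 : ∀ {l} → 0 < l → suc (l ∸ 1) ≡ l
suc-∸1 {suc l} _ = refl

∸1< : ∀ {l} → 0 < l → l ∸ 1 < l
∸1< {suc l} _ = ≤-refl

suc≡⇒≡∸1 : ∀ {k l} → suc k ≡ l → k ≡ l ∸ 1
suc≡⇒≡∸1 refl = refl

splice : ∀ {X : Set} → ℕ → (ℕ → X) → (ℕ → X) → ℕ → X
splice zero    f g i       = g i
splice (suc l) f g zero    = f zero
splice (suc l) f g (suc i) = splice l (λ x → f (suc x)) g i

splice-< : ∀ {X : Set} l (f g : ℕ → X) i → i < l → splice l f g i ≡ f i
splice-< (suc l) f g zero    _         = refl
splice-< (suc l) f g (suc i) (s≤s i<l) = splice-< l (λ x → f (suc x)) g i i<l

splice-≤ : ∀ {X : Set} l (f g : ℕ → X) → f l ≡ g 0 → ∀ i → i ≤ l → splice l f g i ≡ f i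
splice-≤ zero    f g glue zero    z≤n       = sym glue
splice-≤ (suc l) f g glue zero    _         = refl
splice-≤ (suc l) f g glue (suc i) (s≤s i≤l) = splice-≤ l (λ x → f (suc x)) g glue i i≤l

splice-+ : ∀ {X : Set} l (f g : ℕ → X) i → splice l f g (l + i) ≡ g i
splice-+ zero    f g i = refl
splice-+ (suc l) f g i = splice-+ l (λ x → f (suc x)) g i

extend : ∀ {X : Set} n → (Fin n → X) → X → ℕ → X
extend zero    f d i       = d
extend (suc n) f d zero    = f zero
extend (suc n) f d (suc i) = extend n (λ x → f (suc x)) d i

extend-toℕ : ∀ {X : Set} n (f : Fin n → X) d i → extend n f d (toℕ i) ≡ f i
extend-toℕ (suc n) f d zero    = refl
extend-toℕ (suc n) f d (suc i) = extend-toℕ n (λ x → f (suc x)) d i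

toℕ≡n⇒≡fromℕ : ∀ {n} (a : Fin (suc n)) → toℕ a ≡ n → a ≡ fromℕ n
toℕ≡n⇒≡fromℕ {n} a eq = toℕ-injective (trans eq (sym (toℕ-fromℕ n)))

module _ (G : ColGraph) where
  open ColGraph G

  joins-≢ : ∀ {e u v} → Joins G e u v → u ≢ v
  joins-≢ = proj₁

  joins-∈ˡ : ∀ {e u v} → Joins G e u v → u ∈ₑ ψ e
  joins-∈ˡ (_ , ends) = proj₂ (ends _) (inj₁ refl)

  joins-∈ʳ : ∀ {e u v} → Joins G e u v → v ∈ₑ ψ e
  joins-∈ʳ (_ , ends) = proj₂ (ends _) (inj₂ refl)

  joins-sym : ∀ {e u v} → Joins G e u v → Joins G e v u
  joins-sym (u≢v , ends) = (λ v≡u → u≢v (sym v≡u)) , λ w →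
    (λ w∈ → swap (proj₁ (ends w) w∈)) , (λ w≡ → proj₂ (ends w) (swap w≡))
    where
    swap : ∀ {A B : Set} → A ⊎ B → B ⊎ A
    swap = [ inj₂ , inj₁ ]′

  joins-endpointˡ : ∀ {e a b x y} → Joins G e a b → Joins G e x y → a ≡ x ⊎ a ≡ y
  joins-endpointˡ j (_ , ends) = proj₁ (ends _) (joins-∈ˡ j)

  joins-endpointʳ : ∀ {e a b x y} → Joins G e a b → Joins G e x y → b ≡ x ⊎ b ≡ y
  joins-endpointʳ j (_ , ends) = proj₁ (ends _) (joins-∈ʳ j)

  -- A walk with vertices and edges indexed by ℕ: only V i for i ≤ ℓ and E i for i < ℓ matter.
  record Walk : Set where
    constructor walk
    field
      ℓ     : ℕ
      V     : ℕ → Vtx G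
      E     : ℕ → Edge G
      joins : ∀ i → i < ℓ → Joins G (E i) (V i) (V (suc i))
  open Walk public

  VertexInjective : Walk → Set
  VertexInjective w = ∀ i j → i ≤ ℓ w → j ≤ ℓ w → V w i ≡ V w j → i ≡ j

  CycleInjective : Walk → Set
  CycleInjective w = ∀ i j → i < ℓ w → j < ℓ w → V w i ≡ V w j → i ≡ j

  EdgeInjective : Walk → Set
  EdgeInjective w = ∀ i j → i < ℓ w → j < ℓ w → E w i ≡ E w j → i ≡ j

  CuspAt : Walk → ℕ → Set
  CuspAt w k = c (E w k) (V w (suc k)) ≡ c (E w (suc k)) (V w (suc k))

  CuspFreeBelow : Walk → ℕ → Set
  CuspFreeBelow w m = ∀ k → suc k < m → ¬ CuspAt w k

  CuspFreeWalk : Walk → Set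
  CuspFreeWalk w = CuspFreeBelow w (ℓ w)

  _∈ʷ_ : Vtx G → Walk → Set
  x ∈ʷ w = Σ ℕ λ i → i ≤ ℓ w × V w i ≡ x

  segment : (w : Walk) (a L : ℕ) → a + L ≤ ℓ w → Walk
  segment w a L a+L≤ℓ = walk L (λ i → V w (a + i)) (λ i → E w (a + i)) step
    where
    step : ∀ i → i < L → Joins G (E w (a + i)) (V w (a + i)) (V w (a + suc i))
    step i i<L rewrite +-suc a i = joins w (a + i) (<-≤-trans (+-monoʳ-< a i<L) a+L≤ℓ)

  concat : (w₁ w₂ : Walk) → V w₁ (ℓ w₁) ≡ V w₂ 0 → Walk
  concat w₁ w₂ glue = walk (ℓ w₁ + ℓ w₂) V′ E′ step
    where
    l₁ = ℓ w₁
    V′ = splice l₁ (V w₁) (V w₂)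
    E′ = splice l₁ (E w₁) (E w₂)
    step : ∀ i → i < l₁ + ℓ w₂ → Joins G (E′ i) (V′ i) (V′ (suc i))
    step i i< with <-or-+ l₁ i
    ... | inj₁ i<l₁
      rewrite splice-< l₁ (E w₁) (E w₂) i i<l₁ | splice-≤ l₁ (V w₁) (V w₂) glue i (<⇒≤ i<l₁)
            | splice-≤ l₁ (V w₁) (V w₂) glue (suc i) i<l₁
      = joins w₁ i i<l₁
    ... | inj₂ (d , refl)
      rewrite splice-+ l₁ (E w₁) (E w₂) d | splice-+ l₁ (V w₁) (V w₂) d
            | sym (+-suc l₁ d) | splice-+ l₁ (V w₁) (V w₂) (suc d)
      = joins w₂ d (+-cancelˡ-≤ l₁ (suc d) (ℓ w₂) i<)

  reverse : Walk → Walk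
  reverse w = walk (ℓ w) (λ i → V w (ℓ w ∸ i)) (λ i → E w (ℓ w ∸ suc i)) step
    where
    step : ∀ i → i < ℓ w → Joins G (E w (ℓ w ∸ suc i)) (V w (ℓ w ∸ i)) (V w (ℓ w ∸ suc i))
    step i i<ℓ = subst (λ z → Joins G (E w (ℓ w ∸ suc i)) (V w z) (V w (ℓ w ∸ suc i)))
                   (sym (+-∸-assoc 1 i<ℓ))
                   (joins-sym (joins w (ℓ w ∸ suc i) (∸-monoʳ-< {ℓ w} {suc i} {0} z<s i<ℓ)))

  module Concat (w₁ w₂ : Walk) (glue : V w₁ (ℓ w₁) ≡ V w₂ 0) where
    private
      w  = concat w₁ w₂ glue
      l₁ = ℓ w₁

    V-left : ∀ i → i ≤ l₁ → V w i ≡ V w₁ i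
    V-left = splice-≤ l₁ (V w₁) (V w₂) glue

    V-right : ∀ i → V w (l₁ + i) ≡ V w₂ i
    V-right = splice-+ l₁ (V w₁) (V w₂)

    E-left : ∀ i → i < l₁ → E w i ≡ E w₁ i
    E-left = splice-< l₁ (E w₁) (E w₂)

    E-right : ∀ i → E w (l₁ + i) ≡ E w₂ i
    E-right = splice-+ l₁ (E w₁) (E w₂)

    vertexInjective : VertexInjective w₁ → VertexInjective w₂ →
      (∀ x y → x ≤ l₁ → y ≤ ℓ w₂ → V w₁ x ≡ V w₂ y → x ≡ l₁) → VertexInjective w
    vertexInjective inj₁′ inj₂′ meet i j i≤ j≤ eq with <-or-+ l₁ i | <-or-+ l₁ j
    ... | inj₁ i<l₁ | inj₁ j<l₁ =
      inj₁′ i j (<⇒≤ i<l₁) (<⇒≤ j<l₁) (trans (sym (V-left i (<⇒≤ i<l₁))) (trans eq (V-left j (<⇒≤ j<l₁))))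
    ... | inj₁ i<l₁ | inj₂ (d , refl) = ⊥-elim (<⇒≢ i<l₁
      (meet i d (<⇒≤ i<l₁) (+-cancelˡ-≤ l₁ d (ℓ w₂) j≤)
            (trans (sym (V-left i (<⇒≤ i<l₁))) (trans eq (V-right d)))))
    ... | inj₂ (d , refl) | inj₁ j<l₁ = ⊥-elim (<⇒≢ j<l₁
      (meet j d (<⇒≤ j<l₁) (+-cancelˡ-≤ l₁ d (ℓ w₂) i≤)
            (trans (sym (V-left j (<⇒≤ j<l₁))) (trans (sym eq) (V-right d)))))
    ... | inj₂ (d , refl) | inj₂ (d′ , refl) = cong (l₁ +_)
      (inj₂′ d d′ (+-cancelˡ-≤ l₁ d (ℓ w₂) i≤) (+-cancelˡ-≤ l₁ d′ (ℓ w₂) j≤)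
             (trans (sym (V-right d)) (trans eq (V-right d′))))

    cycleInjective : VertexInjective w₁ → VertexInjective w₂ →
      (∀ x y → x ≤ l₁ → y ≤ ℓ w₂ → V w₁ x ≡ V w₂ y → x ≡ l₁ ⊎ y ≡ ℓ w₂) → CycleInjective w
    cycleInjective inj₁′ inj₂′ meet i j i< j< eq with <-or-+ l₁ i | <-or-+ l₁ j
    ... | inj₁ i<l₁ | inj₁ j<l₁ =
      inj₁′ i j (<⇒≤ i<l₁) (<⇒≤ j<l₁) (trans (sym (V-left i (<⇒≤ i<l₁))) (trans eq (V-left j (<⇒≤ j<l₁))))
    ... | inj₁ i<l₁ | inj₂ (d , refl) = ⊥-elim ([ <⇒≢ i<l₁ , <⇒≢ d< ]′
      (meet i d (<⇒≤ i<l₁) (<⇒≤ d<) (trans (sym (V-left i (<⇒≤ i<l₁))) (trans eq (V-right d)))))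
      where d< = +-cancelˡ-< l₁ d (ℓ w₂) j<
    ... | inj₂ (d , refl) | inj₁ j<l₁ = ⊥-elim ([ <⇒≢ j<l₁ , <⇒≢ d< ]′
      (meet j d (<⇒≤ j<l₁) (<⇒≤ d<) (trans (sym (V-left j (<⇒≤ j<l₁))) (trans (sym eq) (V-right d)))))
      where d< = +-cancelˡ-< l₁ d (ℓ w₂) i<
    ... | inj₂ (d , refl) | inj₂ (d′ , refl) = cong (l₁ +_)
      (inj₂′ d d′ (<⇒≤ (+-cancelˡ-< l₁ d (ℓ w₂) i<)) (<⇒≤ (+-cancelˡ-< l₁ d′ (ℓ w₂) j<))
             (trans (sym (V-right d)) (trans eq (V-right d′))))

    cusp-left : ∀ k → suc k < l₁ → CuspAt w k → CuspAt w₁ k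
    cusp-left k 1+k<l₁ cusp
      rewrite E-left k (<⇒≤ 1+k<l₁) | E-left (suc k) 1+k<l₁ | V-left (suc k) (<⇒≤ 1+k<l₁) = cusp

    cusp-junction : ∀ k → suc k ≡ l₁ → CuspAt w k → c (E w₁ k) (V w₂ 0) ≡ c (E w₂ 0) (V w₂ 0)
    cusp-junction k refl cusp =
      trans (sym (cong₂ c (E-left k ≤-refl) junction)) (trans cusp (cong₂ c (trans (cong (E w) l₁≡) (E-right 0)) junction))
      where
      l₁≡ : suc k ≡ l₁ + 0
      l₁≡ = sym (+-identityʳ l₁)
      junction : V w (suc k) ≡ V w₂ 0
      junction = trans (cong (V w) l₁≡) (V-right 0)

    cusp-right : ∀ k → CuspAt w (l₁ + k) → CuspAt w₂ k
    cusp-right k cusp rewrite sym (+-suc l₁ k) | E-right k | E-right (suc k) | V-right (suc k) = cusp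

    ∈-concat : ∀ x → x ∈ʷ w → x ∈ʷ w₁ ⊎ x ∈ʷ w₂
    ∈-concat x (i , i≤ , eq) with <-or-+ l₁ i
    ... | inj₁ i<l₁ = inj₁ (i , <⇒≤ i<l₁ , trans (sym (V-left i (<⇒≤ i<l₁))) eq)
    ... | inj₂ (d , refl) = inj₂ (d , +-cancelˡ-≤ l₁ d (ℓ w₂) i≤ , trans (sym (V-right d)) eq)

  record IsCycle (C : Walk) : Set where
    field
      injective : CycleInjective C
      closed    : V C (ℓ C) ≡ V C 0
      nonempty   : 0 < ℓ C
  open IsCycle public

  closed-at : ∀ {C} → IsCycle C → ∀ {x} → x ≡ ℓ C → V C x ≡ V C 0
  closed-at cyc refl = closed cyc

  segment-vertexInjective : ∀ w a L h → VertexInjective w → VertexInjective (segment w a L h)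
  segment-vertexInjective w a L h inj i j i≤ j≤ eq =
    +-cancelˡ-≡ a i j (inj (a + i) (a + j) (≤-trans (+-monoʳ-≤ a i≤) h) (≤-trans (+-monoʳ-≤ a j≤) h) eq)

  module _ (C : Walk) (cyc : IsCycle C) (a L : ℕ) (h : a + L ≤ ℓ C) (short-or-shifted : a + L < ℓ C ⊎ 0 < a) where
    private
      wraps : a + L ≡ ℓ C → 0 < a
      wraps a+L≡ℓ = [ (λ a+L<ℓ → ⊥-elim (<⇒≢ a+L<ℓ a+L≡ℓ)) , (λ 0<a → 0<a) ]′ short-or-shifted
      interior≢end : ∀ {x y} → a + x < ℓ C → y ≤ L → a + y ≡ ℓ C → V C (a + x) ≢ V C (a + y)
      interior≢end {x} ax<ℓ y≤ ay≡ℓ eq = <⇒≢ (wraps (≤-antisym h (subst (_≤ a + L) ay≡ℓ (+-monoʳ-≤ a y≤))))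
        (sym (m+n≡0⇒m≡0 a (injective cyc (a + x) 0 ax<ℓ (≤-<-trans z≤n ax<ℓ) (trans eq (closed-at cyc ay≡ℓ)))))

    -- A segment of a cycle is injective unless it runs all the way round from the base point.
    segment-of-cycle-vertexInjective : VertexInjective (segment C a L h)
    segment-of-cycle-vertexInjective i j i≤ j≤ eq
      with m≤n⇒m<n∨m≡n (≤-trans (+-monoʳ-≤ a i≤) h) | m≤n⇒m<n∨m≡n (≤-trans (+-monoʳ-≤ a j≤) h)
    ... | inj₁ ai<ℓ | inj₁ aj<ℓ = +-cancelˡ-≡ a i j (injective cyc _ _ ai<ℓ aj<ℓ eq)
    ... | inj₂ ai≡ℓ | inj₂ aj≡ℓ = +-cancelˡ-≡ a i j (trans ai≡ℓ (sym aj≡ℓ))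
    ... | inj₁ ai<ℓ | inj₂ aj≡ℓ = ⊥-elim (interior≢end ai<ℓ j≤ aj≡ℓ eq)
    ... | inj₂ ai≡ℓ | inj₁ aj<ℓ = ⊥-elim (interior≢end aj<ℓ i≤ ai≡ℓ (sym eq))

  segment-cusp : ∀ w a L h k → CuspAt (segment w a L h) k → CuspAt w (a + k)
  segment-cusp w a L h k cusp rewrite +-suc a k = cusp

  segment-cuspFree : ∀ w a L h → CuspFreeWalk w → CuspFreeWalk (segment w a L h)
  segment-cuspFree w a L h cf k 1+k<L cusp =
    cf (a + k) (<-≤-trans (subst (_< a + L) (+-suc a k) (+-monoʳ-< a 1+k<L)) h) (segment-cusp w a L h k cusp)

  reverse-vertexInjective : ∀ w → VertexInjective w → VertexInjective (reverse w)
  reverse-vertexInjective w inj i j i≤ j≤ eq = ∸-cancelˡ-≡ i≤ j≤ (inj _ _ (m∸n≤m (ℓ w) i) (m∸n≤m (ℓ w) j) eq)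

  reverse-isCycle : ∀ C → IsCycle C → IsCycle (reverse C)
  reverse-isCycle C cyc = record
    { injective = inj
    ; closed    = trans (cong (V C) (n∸n≡0 (ℓ C))) (sym (closed cyc))
    ; nonempty   = nonempty cyc }
    where
    ℓ∸1+ : ∀ {i} → i < ℓ C → ℓ C ∸ suc i < ℓ C
    ℓ∸1+ {i} i< = ∸-monoʳ-< {ℓ C} {suc i} {0} z<s i<
    base≢ : ∀ {i} → suc i < ℓ C → V C (ℓ C) ≢ V C (ℓ C ∸ suc i)
    base≢ 1+i< eq =
      <⇒≢ (m<n⇒0<n∸m 1+i<) (injective cyc 0 _ (nonempty cyc) (ℓ∸1+ (<⇒≤ 1+i<)) (trans (sym (closed cyc)) eq))
    inj : CycleInjective (reverse C)
    inj zero    zero    _  _  _  = refl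
    inj zero    (suc j) _  j< eq = ⊥-elim (base≢ j< eq)
    inj (suc i) zero    i< _  eq = ⊥-elim (base≢ i< (sym eq))
    inj (suc i) (suc j) i< j< eq =
      ∸-cancelˡ-≡ (<⇒≤ i<) (<⇒≤ j<) (injective cyc _ _ (ℓ∸1+ (<⇒≤ i<)) (ℓ∸1+ (<⇒≤ j<)) eq)

  reverse-cusp : ∀ w k → suc k < ℓ w → CuspAt (reverse w) k → CuspAt w (ℓ w ∸ suc (suc k))
  reverse-cusp w k 1+k< cusp rewrite sym (+-∸-assoc 1 1+k<) = sym cusp

  reverse-cuspFree : ∀ w → CuspFreeWalk w → CuspFreeWalk (reverse w)
  reverse-cuspFree w cf k 1+k< cusp = cf (ℓ w ∸ suc (suc k)) bound (reverse-cusp w k 1+k< cusp)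
    where
    bound : suc (ℓ w ∸ suc (suc k)) < ℓ w
    bound = subst (_< ℓ w) (+-∸-assoc 1 1+k<) (∸-monoʳ-< {ℓ w} {suc k} {0} z<s (<⇒≤ 1+k<))

  vertexInjective⇒edgeInjective : ∀ w → VertexInjective w → EdgeInjective w
  vertexInjective⇒edgeInjective w inj a b a< b< eq
    with joins-endpointˡ (joins w a a<) joins-b | joins-endpointʳ (joins w a a<) joins-b
    where joins-b = subst (λ e → Joins G e (V w b) (V w (suc b))) (sym eq) (joins w b b<)
  ... | inj₁ Va≡Vb | _ = inj a b (<⇒≤ a<) (<⇒≤ b<) Va≡Vb
  ... | inj₂ Va≡Vb+1 | Va+1≡ with inj a (suc b) (<⇒≤ a<) b< Va≡Vb+1
  ...   | refl = ⊥-elim ([ (λ e → m+1+n≢n 1 (inj _ _ a< (<⇒≤ b<) e)) , (λ e → 1+n≢n (inj _ _ a< b< e)) ]′ Va+1≡)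

  module _ (C : Walk) (cyc : IsCycle C) (no-digon : ℓ C ≡ 2 → E C 0 ≢ E C 1) where
    private
      shared-edge : ∀ a b → a < b → b < ℓ C → Joins G (E C a) (V C b) (V C (suc b)) → E C a ≢ E C b
      shared-edge a b a<b b<ℓ joins-b eq with joins-endpointˡ (joins C a (<-trans a<b b<ℓ)) joins-b
      ... | inj₁ Va≡Vb = <⇒≢ a<b (injective cyc a b (<-trans a<b b<ℓ) b<ℓ Va≡Vb)
      ... | inj₂ Va≡Vb+1 with m≤n⇒m<n∨m≡n b<ℓ
      ...   | inj₁ b+1<ℓ = <⇒≢ (<-trans a<b (n<1+n b)) (injective cyc a (suc b) (<-trans a<b b<ℓ) b+1<ℓ Va≡Vb+1)
      ...   | inj₂ b+1≡ℓ with injective cyc a 0 (<-trans a<b b<ℓ) (nonempty cyc) (trans Va≡Vb+1 (closed-at cyc b+1≡ℓ))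
      ...     | refl with joins-endpointʳ (joins C 0 (nonempty cyc)) joins-b
      ...       | inj₂ V1≡Vb+1 = joins-≢ (joins C 0 (nonempty cyc)) (sym (trans V1≡Vb+1 (closed-at cyc b+1≡ℓ)))
      ...       | inj₁ V1≡Vb with injective cyc 1 b (≤-<-trans a<b b<ℓ) b<ℓ V1≡Vb
      ...         | refl = no-digon (sym b+1≡ℓ) eq

      edges-distinct : ∀ a b → a < b → b < ℓ C → E C a ≢ E C b
      edges-distinct a b a<b b<ℓ eq =
        shared-edge a b a<b b<ℓ (subst (λ e → Joins G e (V C b) (V C (suc b))) (sym eq) (joins C b b<ℓ)) eq

    cycle-edgeInjective : EdgeInjective C
    cycle-edgeInjective a b a< b< eq with <-cmp a b
    ... | tri< a<b _ _ = ⊥-elim (edges-distinct a b a<b b< eq)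
    ... | tri≈ _ a≡b _ = a≡b
    ... | tri> _ _ b<a = ⊥-elim (edges-distinct b a b<a a< (sym eq))

  record WalkArrow (v : Vtx G) (α : Color G) (w : Walk) (u : Vtx G) (β : Color G) : Set where
    field
      simple     : VertexInjective w
      cuspFree   : CuspFreeWalk w
      starts     : V w 0 ≡ v
      ends       : V w (ℓ w) ≡ u
      nonempty   : 0 < ℓ w
      startColor : c (E w 0) v ≢ α
      endColor   : c (E w (ℓ w ∸ 1)) u ≡ β
  open WalkArrow public

  Unreachable : Vtx G → Color G → Walk → Set
  Unreachable u β w = ∀ x τ q → WalkArrow u β q x τ → ¬ x ∈ʷ w

  WalkLhd : Vtx G → Color G → Vtx G → Color G → Set
  WalkLhd v α u β = Σ Walk λ w → WalkArrow v α w u β × Unreachable u β w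

  prefix-arrow : ∀ {v α w u β} → WalkArrow v α w u β → ∀ t → 0 < t → (t≤ : t ≤ ℓ w) →
    WalkArrow v α (segment w 0 t t≤) (V w t) (c (E w (t ∸ 1)) (V w t))
  prefix-arrow {w = w} ar t 0<t t≤ = record
    { simple     = segment-vertexInjective w 0 t t≤ (simple ar)
    ; cuspFree   = segment-cuspFree w 0 t t≤ (cuspFree ar)
    ; starts     = starts ar
    ; ends       = refl
    ; nonempty   = 0<t
    ; startColor = startColor ar
    ; endColor   = refl }

  concat-arrow : ∀ {v α p w γ q u β} (ap : WalkArrow v α p w γ) (aq : WalkArrow w γ q u β) →
    (∀ x y → x ≤ ℓ p → y ≤ ℓ q → V p x ≡ V q y → x ≡ ℓ p) →
    WalkArrow v α (concat p q (trans (ends ap) (sym (starts aq)))) u β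
  concat-arrow {v} {α} {p} {w} {γ} {q} {u} ap aq meet = record
    { simple     = vertexInjective (simple ap) (simple aq) meet
    ; cuspFree   = cuspFree′
    ; starts     = trans (V-left 0 z≤n) (starts ap)
    ; ends       = trans (V-right (ℓ q)) (ends aq)
    ; nonempty   = ≤-trans (nonempty ap) (m≤m+n (ℓ p) (ℓ q))
    ; startColor = subst (λ e → c e v ≢ α) (sym (E-left 0 (nonempty ap))) (startColor ap)
    ; endColor   = trans (cong (λ e → c e u) last-edge) (endColor aq) }
    where
    glue = trans (ends ap) (sym (starts aq))
    pq = concat p q glue
    open Concat p q glue
    last-edge : E pq (ℓ pq ∸ 1) ≡ E q (ℓ q ∸ 1)
    last-edge = trans (cong (E pq) (+-∸-assoc (ℓ p) (nonempty aq))) (E-right (ℓ q ∸ 1))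
    cuspFree′ : CuspFreeWalk pq
    cuspFree′ k 1+k< cusp with <-or-+ (ℓ p) k
    ... | inj₂ (d , refl) = cuspFree aq d (+-cancelˡ-< (ℓ p) (suc d) (ℓ q) (subst (_< ℓ p + ℓ q) (sym (+-suc (ℓ p) d)) 1+k<))
                                      (cusp-right d cusp)
    ... | inj₁ k<ℓp with m≤n⇒m<n∨m≡n k<ℓp
    ...   | inj₁ 1+k<ℓp = cuspFree ap k 1+k<ℓp (cusp-left k 1+k<ℓp cusp)
    ...   | inj₂ refl = startColor aq (begin
      c (E q 0) w                 ≡⟨ subst (λ z → c (E p k) z ≡ c (E q 0) z) (starts aq) (cusp-junction k refl cusp) ⟨
      c (E p k) w                 ≡⟨ endColor ap ⟩
      γ                           ∎)
      where open ≡-Reasoning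

  -- Any vertex of q other than its start is the end of an arrow (a prefix of q).
  unreachable-meet : ∀ {v α p w γ q u β} → WalkArrow v α p w γ → WalkArrow w γ q u β → Unreachable w γ p →
    ∀ x y → x ≤ ℓ p → y ≤ ℓ q → V p x ≡ V q y → x ≡ ℓ p
  unreachable-meet ap aq _ x zero x≤ _ eq = simple ap _ _ x≤ ≤-refl (trans eq (trans (starts aq) (sym (ends ap))))
  unreachable-meet ap aq unreachable x (suc y) x≤ y≤ eq =
    ⊥-elim (unreachable _ _ _ (prefix-arrow aq (suc y) z<s y≤) (x , x≤ , eq))

  walkLhd-trans : ∀ {v α w γ u β} → WalkLhd v α w γ → WalkLhd w γ u β → WalkLhd v α u β
  walkLhd-trans (p , ap , p-unreachable) (q , aq , q-unreachable) =
    concat p q glue , concat-arrow ap aq (unreachable-meet ap aq p-unreachable) , unreachable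
    where
    glue = trans (ends ap) (sym (starts aq))
    unreachable : Unreachable _ _ (concat p q glue)
    unreachable x τ r ar x∈pq with Concat.∈-concat p q glue x x∈pq
    ... | inj₂ x∈q = q-unreachable x τ r ar x∈q
    ... | inj₁ x∈p = p-unreachable x τ (concat q r _) (concat-arrow aq ar (unreachable-meet aq ar q-unreachable)) x∈p

  -- The default edge d fills the (never used) positions past the end of the path.
  module _ (p : Path G) (d : Edge G) where
    private
      V′ = extend (suc (len p)) (vs p) (vs p zero)
      E′ = extend (len p) (es p) d

    toWalk-V : ∀ i → V′ (toℕ i) ≡ vs p i
    toWalk-V = extend-toℕ (suc (len p)) (vs p) (vs p zero)

    toWalk-E : ∀ i → E′ (toℕ i) ≡ es p i
    toWalk-E = extend-toℕ (len p) (es p) d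

    toWalk-V< : ∀ i (i< : i < suc (len p)) → V′ i ≡ vs p (fromℕ< i<)
    toWalk-V< i i< = trans (cong V′ (sym (toℕ-fromℕ< i<))) (toWalk-V (fromℕ< i<))

    toWalk-E< : ∀ i (i< : i < len p) → E′ i ≡ es p (fromℕ< i<)
    toWalk-E< i i< = trans (cong E′ (sym (toℕ-fromℕ< i<))) (toWalk-E (fromℕ< i<))

    toWalk : Walk
    toWalk = walk (len p) V′ E′ step
      where
      step : ∀ i → i < len p → Joins G (E′ i) (V′ i) (V′ (suc i))
      step i i< = subst₂ (Joins G (E′ i)) (sym Vi) (sym Vi+1)
                    (subst (λ e → Joins G e (vs p (inject₁ i′)) (vs p (suc i′))) (sym (toWalk-E< i i<)) (valid p i′))
        where
        i′ = fromℕ< i<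
        Vi : V′ i ≡ vs p (inject₁ i′)
        Vi = trans (cong V′ (sym (trans (toℕ-inject₁ i′) (toℕ-fromℕ< i<)))) (toWalk-V (inject₁ i′))
        Vi+1 : V′ (suc i) ≡ vs p (suc i′)
        Vi+1 = trans (cong V′ (cong suc (sym (toℕ-fromℕ< i<)))) (toWalk-V (suc i′))

  fromWalk : Walk → Path G
  fromWalk w = record
    { len   = ℓ w
    ; vs    = λ i → V w (toℕ i)
    ; es    = λ i → E w (toℕ i)
    ; valid = λ i → subst (λ z → Joins G (E w (toℕ i)) (V w z) (V w (suc (toℕ i)))) (sym (toℕ-inject₁ i))
                          (joins w (toℕ i) (toℕ<n i)) }

  fromWalk-end : ∀ w → end G (fromWalk w) ≡ V w (ℓ w)
  fromWalk-end w = cong (V w) (toℕ-fromℕ (ℓ w))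

  toWalk-end : ∀ p d → V (toWalk p d) (ℓ (toWalk p d)) ≡ end G p
  toWalk-end p d = trans (cong (V (toWalk p d)) (sym (toℕ-fromℕ (len p)))) (toWalk-V p d (fromℕ (len p)))

  cusp⇒pathCuspAt : (p : Path G) → (∀ i j → es p i ≡ es p j → i ≡ j) → (i j : Fin (len p)) →
    toℕ j ≡ suc (toℕ i) → c (es p i) (vs p (suc i)) ≡ c (es p j) (vs p (suc i)) → PathCuspAt G p (vs p (suc i))
  cusp⇒pathCuspAt p edge-inj i j j≡i+1 same-color = inner i j j≡i+1 refl (i≢j , joins-∈ʳ (valid p i) , ∈j , same-color)
    where
    i≢j : es p i ≢ es p j
    i≢j eq = 1+n≢n (sym (trans (cong toℕ (edge-inj i j eq)) j≡i+1))
    ∈j : vs p (suc i) ∈ₑ ψ (es p j)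
    ∈j = subst (λ z → vs p z ∈ₑ ψ (es p j)) (toℕ-injective (trans (toℕ-inject₁ j) j≡i+1)) (joins-∈ˡ (valid p j))

  arrow⇒walkArrow : ∀ {v α p u β} → (d : Edge G) → Arrow G v α p u β → WalkArrow v α (toWalk p d) u β
  arrow⇒walkArrow {α = α} {p} {u} {β} d
    ((edge-inj , vertex-inj) , open′ , cusp-free , starts′ , ends′ , ¬start , (i , i+1≡ , end-color)) = record
    { simple     = simple′
    ; cuspFree   = cuspFree′
    ; starts     = trans (toWalk-V p d zero) starts′
    ; ends       = trans (toWalk-end p d) ends′
    ; nonempty   = 0<len
    ; startColor = λ eq → ¬start (fromℕ< 0<len , toℕ-fromℕ< 0<len ,
                                   subst₂ (λ a b → c a b ≡ α) (toWalk-E< p d 0 0<len) (sym starts′) eq)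
    ; endColor   = subst (λ z → c (E w z) u ≡ β) (suc≡⇒≡∸1 i+1≡)
                      (subst (λ a → c a u ≡ β) (sym (toWalk-E p d i)) (subst (λ b → c (es p i) b ≡ β) ends′ end-color)) }
    where
    w = toWalk p d
    0<len : 0 < len p
    0<len = ≤-<-trans z≤n (toℕ<n i)
    same-index : ∀ a b → vs p a ≡ vs p b → a ≡ b
    same-index a b eq with vertex-inj a b eq
    ... | inj₁ a≡b = a≡b
    ... | inj₂ (inj₁ a≡0 , inj₁ b≡0) = toℕ-injective (trans a≡0 (sym b≡0))
    ... | inj₂ (inj₂ a≡n , inj₂ b≡n) = toℕ-injective (trans a≡n (sym b≡n))
    ... | inj₂ (inj₁ a≡0 , inj₂ b≡n) =
      ⊥-elim (open′ (subst₂ (λ a′ b′ → vs p a′ ≡ vs p b′) (toℕ-injective a≡0) (toℕ≡n⇒≡fromℕ b b≡n) eq))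
    ... | inj₂ (inj₂ a≡n , inj₁ b≡0) =
      ⊥-elim (open′ (subst₂ (λ a′ b′ → vs p a′ ≡ vs p b′) (toℕ-injective b≡0) (toℕ≡n⇒≡fromℕ a a≡n) (sym eq)))
    simple′ : VertexInjective w
    simple′ i j i≤ j≤ eq =
      trans (sym (toℕ-fromℕ< (s≤s i≤))) (trans (cong toℕ (same-index _ _ eq′)) (toℕ-fromℕ< (s≤s j≤)))
      where eq′ = trans (sym (toWalk-V< p d i (s≤s i≤))) (trans eq (toWalk-V< p d j (s≤s j≤)))
    cuspFree′ : CuspFreeWalk w
    cuspFree′ k 1+k< cusp = cusp-free (_ , cusp⇒pathCuspAt p edge-inj k′ k+1′ index≡ same-color)
      where
      k′ = fromℕ< (<⇒≤ 1+k<)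
      k+1′ = fromℕ< 1+k<
      index≡ : toℕ k+1′ ≡ suc (toℕ k′)
      index≡ = trans (toℕ-fromℕ< 1+k<) (cong suc (sym (toℕ-fromℕ< (<⇒≤ 1+k<))))
      V-k+1 : V w (suc k) ≡ vs p (suc k′)
      V-k+1 = trans (cong (V w) (cong suc (sym (toℕ-fromℕ< (<⇒≤ 1+k<))))) (toWalk-V p d (suc k′))
      same-color : c (es p k′) (vs p (suc k′)) ≡ c (es p k+1′) (vs p (suc k′))
      same-color = subst₂ (λ a b → c a b ≡ c (es p k+1′) b) (toWalk-E< p d k (<⇒≤ 1+k<)) V-k+1
                      (subst (λ a → c (E w k) (V w (suc k)) ≡ c a (V w (suc k))) (toWalk-E< p d (suc k) 1+k<) cusp)

  walkArrow⇒arrow : ∀ {v α w u β} → WalkArrow v α w u β → Arrow G v α (fromWalk w) u β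
  walkArrow⇒arrow {α = α} {w} {u} {β} ar =
    ( (λ i j eq → toℕ-injective (vertexInjective⇒edgeInjective w (simple ar) _ _ (toℕ<n i) (toℕ<n j) eq))
    , (λ i j eq → inj₁ (toℕ-injective (simple ar _ _ (m<1+n⇒m≤n (toℕ<n i)) (m<1+n⇒m≤n (toℕ<n j)) eq))) )
    , open′
    , cusp-free
    , starts ar
    , trans (fromWalk-end w) (ends ar)
    , (λ { (i , i≡0 , color) → startColor ar (subst₂ (λ a b → c a b ≡ α) (cong (E w) i≡0) (starts ar) color) })
    , (fromℕ< ℓ-1< , trans (cong suc (toℕ-fromℕ< ℓ-1<)) (suc-∸1 (nonempty ar))
      , subst₂ (λ a b → c a b ≡ β) (cong (E w) (sym (toℕ-fromℕ< ℓ-1<))) (sym (trans (fromWalk-end w) (ends ar)))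
               (endColor ar))
    where
    ℓ-1< = ∸1< (nonempty ar)
    open′ : Open G (fromWalk w)
    open′ eq = <⇒≢ (nonempty ar) (simple ar 0 (ℓ w) z≤n ≤-refl (trans eq (fromWalk-end w)))
    cusp-free : CuspFree G (fromWalk w)
    cusp-free (_ , inner i j j≡i+1 _ (_ , _ , _ , color)) =
      cuspFree ar (toℕ i) (subst (_< ℓ w) j≡i+1 (toℕ<n j))
        (subst (λ z → c (E w (toℕ i)) (V w (suc (toℕ i))) ≡ c (E w z) (V w (suc (toℕ i)))) j≡i+1 color)
    cusp-free (_ , closing closed′ _ _ _ _ _ _) = open′ closed′

  ∈-toWalk : ∀ {x} p d → x ∈ʷ toWalk p d → OccursIn G x p
  ∈-toWalk p d (i , i≤ , eq) = fromℕ< (s≤s i≤) , trans (sym (toWalk-V< p d i (s≤s i≤))) eq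

  ∈-fromWalk : ∀ {x} w → OccursIn G x (fromWalk w) → x ∈ʷ w
  ∈-fromWalk w (i , eq) = toℕ i , m<1+n⇒m≤n (toℕ<n i) , eq

  last-edge : ∀ {v α p u β} → Arrow G v α p u β → Edge G
  last-edge {p = p} (_ , _ , _ , _ , _ , _ , (i , _)) = es p i

  lhd⇒walkLhd : ∀ {v α u β} → Lhd G v α u β → WalkLhd v α u β
  lhd⇒walkLhd (p , ap , unreachable) = toWalk p (last-edge ap) , arrow⇒walkArrow (last-edge ap) ap ,
    λ x τ q aq x∈ → unreachable x τ (fromWalk q) (walkArrow⇒arrow aq) (∈-toWalk p (last-edge ap) x∈)

  walkLhd⇒lhd : ∀ {v α u β} → WalkLhd v α u β → Lhd G v α u β
  walkLhd⇒lhd (w , ar , unreachable) = fromWalk w , walkArrow⇒arrow ar ,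
    λ x τ q aq x∈ → unreachable x τ (toWalk q (last-edge aq)) (arrow⇒walkArrow (last-edge aq) aq) (∈-fromWalk w x∈)

  CuspAtBase : Walk → Set
  CuspAtBase C = c (E C (ℓ C ∸ 1)) (V C 0) ≡ c (E C 0) (V C 0)

  isCycle⇒cycle : ∀ C → IsCycle C → EdgeInjective C → Cycle G (fromWalk C)
  isCycle⇒cycle C cyc edge-inj =
    ((λ i j eq → toℕ-injective (edge-inj _ _ (toℕ<n i) (toℕ<n j) eq)) , vertex-simple) , closed′ , nonempty cyc
    where
    vertex-simple : ∀ i j → V C (toℕ i) ≡ V C (toℕ j) → i ≡ j ⊎ (IsEndIndex G {ℓ C} i × IsEndIndex G {ℓ C} j)
    vertex-simple i j eq with m≤n⇒m<n∨m≡n (m<1+n⇒m≤n (toℕ<n i)) | m≤n⇒m<n∨m≡n (m<1+n⇒m≤n (toℕ<n j))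
    ... | inj₁ i< | inj₁ j< = inj₁ (toℕ-injective (injective cyc _ _ i< j< eq))
    ... | inj₂ i≡ | inj₂ j≡ = inj₁ (toℕ-injective (trans i≡ (sym j≡)))
    ... | inj₁ i< | inj₂ j≡ =
      inj₂ (inj₁ (injective cyc _ 0 i< (nonempty cyc) (trans eq (closed-at cyc j≡))) , inj₂ j≡)
    ... | inj₂ i≡ | inj₁ j< =
      inj₂ (inj₂ i≡ , inj₁ (injective cyc _ 0 j< (nonempty cyc) (trans (sym eq) (closed-at cyc i≡))))
    closed′ : Closed G (fromWalk C)
    closed′ = sym (trans (fromWalk-end C) (closed cyc))

  cycle⇒isCycle : ∀ p d → Cycle G p → IsCycle (toWalk p d)
  cycle⇒isCycle p d ((_ , vertex-simple) , closed′ , 0<len) = record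
    { injective = injective′
    ; closed    = trans (toWalk-end p d) (trans (sym closed′) (sym (toWalk-V p d zero)))
    ; nonempty   = 0<len }
    where
    L = len p
    as-vertex : ∀ {i} → i < L → Fin (suc L)
    as-vertex i< = fromℕ< (m<n⇒m<1+n i<)
    toℕ-as-vertex : ∀ {i} (i< : i < L) → toℕ (as-vertex i<) ≡ i
    toℕ-as-vertex i< = toℕ-fromℕ< (m<n⇒m<1+n i<)
    interior-end : ∀ {i} (i< : i < L) → IsEndIndex G {L} (as-vertex i<) → i ≡ 0
    interior-end i< (inj₁ i≡0) = trans (sym (toℕ-as-vertex i<)) i≡0
    interior-end i< (inj₂ i≡L) = ⊥-elim (<⇒≢ i< (trans (sym (toℕ-as-vertex i<)) i≡L))
    injective′ : CycleInjective (toWalk p d)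
    injective′ i j i< j< eq
      with vertex-simple (as-vertex i<) (as-vertex j<)
             (trans (sym (toWalk-V< p d i (m<n⇒m<1+n i<))) (trans eq (toWalk-V< p d j (m<n⇒m<1+n j<))))
    ... | inj₁ same = trans (sym (toℕ-as-vertex i<)) (trans (cong toℕ same) (toℕ-as-vertex j<))
    ... | inj₂ (i-end , j-end) = trans (interior-end i< i-end) (sym (interior-end j< j-end))

  pathCusp⇒walkCusp : ∀ C → HasCusp G (fromWalk C) → (∃ λ k → suc k < ℓ C × CuspAt C k) ⊎ CuspAtBase C
  pathCusp⇒walkCusp C (_ , inner i j j≡i+1 _ (_ , _ , _ , color)) =
    inj₁ (toℕ i , subst (_< ℓ C) j≡i+1 (toℕ<n j) ,
          subst (λ z → c (E C (toℕ i)) (V C (suc (toℕ i))) ≡ c (E C z) (V C (suc (toℕ i)))) j≡i+1 color)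
  pathCusp⇒walkCusp C (_ , closing _ i j i≡0 j+1≡ _ (_ , _ , _ , color)) =
    inj₂ (subst₂ (λ a b → c (E C a) (V C 0) ≡ c (E C b) (V C 0)) (suc≡⇒≡∸1 j+1≡) i≡0 color)

  cuspFree-cycle-absurd : NoCuspFreeCycle G → ∀ C → IsCycle C → EdgeInjective C →
    CuspFreeWalk C → ¬ CuspAtBase C → ⊥
  cuspFree-cycle-absurd no-cf-cycle C cyc edge-inj cf no-base-cusp =
    no-cf-cycle (fromWalk C) (isCycle⇒cycle C cyc edge-inj)
      (λ cusp → [ (λ { (k , 1+k< , cuspₖ) → cf k 1+k< cuspₖ }) , no-base-cusp ]′ (pathCusp⇒walkCusp C cusp))

  record UnsplitCycle (v : Vtx G) (α : Color G) (C : Walk) : Set where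
    field
      cycle        : IsCycle C
      based        : V C 0 ≡ v
      leaves       : c (E C 0) v ≢ α
      no-base-cusp : c (E C 0) v ≢ c (E C (ℓ C ∸ 1)) v
  open UnsplitCycle public

  unsplit-edgeInjective : ∀ {v α C} → UnsplitCycle v α C → EdgeInjective C
  unsplit-edgeInjective {v} {C = C} U = cycle-edgeInjective C (cycle U) no-digon
    where
    no-digon : ℓ C ≡ 2 → E C 0 ≢ E C 1
    no-digon ℓ≡2 eq = no-base-cusp U (cong (λ e → c e v) (trans eq (cong (E C) (sym (cong (_∸ 1) ℓ≡2)))))

  -- The cycle C with its arc from index a to index b replaced by R, whose interior avoids C.
  module Bypass (C : Walk) (cyc : IsCycle C) (a b : ℕ) (a<b : a < b) (b<ℓ : b < ℓ C)
                (R : Walk) (R-simple : VertexInjective R) (0<ℓR : 0 < ℓ R)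
                (R-start : V R 0 ≡ V C a) (R-end : V R (ℓ R) ≡ V C b)
                (R-avoids : ∀ y → 0 < y → y < ℓ R → ∀ z → z < ℓ C → V C z ≢ V R y) where
    private
      L₂ = ℓ C ∸ b
      b+L₂≡ℓ : b + L₂ ≡ ℓ C
      b+L₂≡ℓ = m+[n∸m]≡n (<⇒≤ b<ℓ)
      0<L₂ : 0 < L₂
      0<L₂ = m<n⇒0<n∸m b<ℓ
      a<ℓ : a < ℓ C
      a<ℓ = <-trans a<b b<ℓ
      before = segment C 0 a (<⇒≤ a<ℓ)
      after  = segment C b L₂ (≤-reflexive b+L₂≡ℓ)
      glue₁ : V before a ≡ V R 0
      glue₁ = sym R-start
      Q = concat before R glue₁
      lQ = a + ℓ R
      glue₂ : V Q lQ ≡ V after 0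
      glue₂ = trans (Concat.V-right before R glue₁ (ℓ R)) (trans R-end (cong (V C) (sym (+-identityʳ b))))
    C′ = concat Q after glue₂
    private
      module I = Concat before R glue₁
      module O = Concat Q after glue₂
      V-before : ∀ i → i ≤ a → V C′ i ≡ V C i
      V-before i i≤ = trans (O.V-left i (≤-trans i≤ (m≤m+n a (ℓ R)))) (I.V-left i i≤)

    E-before : ∀ i → i < a → E C′ i ≡ E C i
    E-before i i< = trans (O.E-left i (<-≤-trans i< (m≤m+n a _))) (I.E-left i i<)
    E-bypass : ∀ y → y < ℓ R → E C′ (a + y) ≡ E R y
    E-bypass y y< = trans (O.E-left (a + y) (+-monoʳ-< a y<)) (I.E-right y)

    private
      Q-simple : VertexInjective Q
      Q-simple = I.vertexInjective (segment-of-cycle-vertexInjective C cyc 0 a (<⇒≤ a<ℓ) (inj₁ a<ℓ)) R-simple meet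
        where
        meet : ∀ x y → x ≤ a → y ≤ ℓ R → V C (0 + x) ≡ V R y → x ≡ a
        meet x zero    x≤ _  eq = injective cyc x a (≤-<-trans x≤ a<ℓ) a<ℓ (trans eq R-start)
        meet x (suc y) x≤ y≤ eq with m≤n⇒m<n∨m≡n y≤
        ... | inj₁ y< = ⊥-elim (R-avoids (suc y) z<s y< x (≤-<-trans x≤ a<ℓ) eq)
        ... | inj₂ refl = ⊥-elim (<⇒≢ (≤-<-trans x≤ a<b) (injective cyc x b (≤-<-trans x≤ a<ℓ) b<ℓ (trans eq R-end)))
      after-simple : VertexInjective after
      after-simple = segment-of-cycle-vertexInjective C cyc b L₂ (≤-reflexive b+L₂≡ℓ) (inj₂ (≤-trans z<s a<b))
      Q-meets-after : ∀ x z → x ≤ lQ → b ≤ z → z < ℓ C → V Q x ≡ V C z → x ≡ lQ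
      Q-meets-after x z x≤ b≤z z<ℓ eq with <-or-+ a x
      ... | inj₁ x<a = ⊥-elim (<⇒≢ (<-≤-trans x<a (≤-trans (<⇒≤ a<b) b≤z))
                         (injective cyc x z (<-trans x<a a<ℓ) z<ℓ (trans (sym (I.V-left x (<⇒≤ x<a))) eq)))
      ... | inj₂ (zero , refl) = ⊥-elim (<⇒≢ (<-≤-trans a<b b≤z)
                                   (injective cyc a z a<ℓ z<ℓ (trans (sym R-start) (trans (sym (I.V-right 0)) eq))))
      ... | inj₂ (suc x′ , refl) with m≤n⇒m<n∨m≡n (+-cancelˡ-≤ a (suc x′) (ℓ R) x≤)
      ...   | inj₁ x′< = ⊥-elim (R-avoids (suc x′) z<s x′< z z<ℓ (sym (trans (sym (I.V-right (suc x′))) eq)))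
      ...   | inj₂ x′≡ = cong (a +_) x′≡
      meet : ∀ x y → x ≤ lQ → y ≤ L₂ → V Q x ≡ V after y → x ≡ lQ ⊎ y ≡ L₂
      meet x y x≤ y≤ eq with m≤n⇒m<n∨m≡n y≤
      ... | inj₂ y≡L₂ = inj₂ y≡L₂
      ... | inj₁ y<L₂ = inj₁ (Q-meets-after x (b + y) x≤ (m≤m+n b y) (subst (b + y <_) b+L₂≡ℓ (+-monoʳ-< b y<L₂)) eq)

    C′-cycle : IsCycle C′
    C′-cycle = record
      { injective = O.cycleInjective Q-simple after-simple meet
      ; closed    = trans (O.V-right L₂) (trans (closed-at cyc b+L₂≡ℓ) (sym (V-before 0 z≤n)))
      ; nonempty   = ≤-trans 0<L₂ (m≤n+m L₂ lQ) }

    last-edge-unchanged : E C′ (ℓ C′ ∸ 1) ≡ E C (ℓ C ∸ 1)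
    last-edge-unchanged = trans (cong (E C′) (+-∸-assoc lQ 0<L₂))
                   (trans (O.E-right (L₂ ∸ 1)) (cong (E C) (trans (sym (+-∸-assoc b 0<L₂)) (cong (_∸ 1) b+L₂≡ℓ))))

    data BypassCusp (k : ℕ) : Set where
      before-a : suc k < a → CuspAt C k → BypassCusp k
      at-a     : suc k ≡ a → c (E C k) (V C a) ≡ c (E R 0) (V C a) → BypassCusp k
      inside-R : ∀ k′ → k ≡ a + k′ → suc k′ < ℓ R → CuspAt R k′ → BypassCusp k
      at-b     : k ≡ a + (ℓ R ∸ 1) → c (E R (ℓ R ∸ 1)) (V C b) ≡ c (E C b) (V C b) → BypassCusp k
      after-b  : ∀ k′ → k ≡ a + ℓ R + k′ → CuspAt C (b + k′) → BypassCusp k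

    bypass-cusp : ∀ k → CuspAt C′ k → BypassCusp k
    bypass-cusp k cusp with <-or-+ lQ k
    ... | inj₂ (k′ , refl) = after-b k′ refl (segment-cusp C b L₂ (≤-reflexive b+L₂≡ℓ) k′ (O.cusp-right k′ cusp))
    ... | inj₁ k<lQ with m≤n⇒m<n∨m≡n k<lQ
    ...   | inj₂ k+1≡lQ = at-b k≡ (subst₂ (λ e n → c e (V C n) ≡ c (E C n) (V C n))
                                      (trans (cong (E Q) k≡) (I.E-right (ℓ R ∸ 1))) (+-identityʳ b)
                                      (O.cusp-junction k k+1≡lQ cusp))
      where
      k≡ : k ≡ a + (ℓ R ∸ 1)
      k≡ = trans (suc≡⇒≡∸1 k+1≡lQ) (+-∸-assoc a 0<ℓR)
    ...   | inj₁ k+1<lQ with <-or-+ a k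
    ...     | inj₂ (k′ , refl) = inside-R k′ refl (+-cancelˡ-< a (suc k′) (ℓ R) (subst (_< lQ) (sym (+-suc a k′)) k+1<lQ))
                                   (I.cusp-right k′ (O.cusp-left k k+1<lQ cusp))
    ...     | inj₁ k<a with m≤n⇒m<n∨m≡n k<a
    ...       | inj₁ k+1<a = before-a k+1<a (segment-cusp C 0 a (<⇒≤ a<ℓ) k (I.cusp-left k k+1<a (O.cusp-left k k+1<lQ cusp)))
    ...       | inj₂ k+1≡a = at-a k+1≡a (subst (λ z → c (E C k) z ≡ c (E R 0) z) R-start
                                          (I.cusp-junction k k+1≡a (O.cusp-left k k+1<lQ cusp)))

    unsplit : ∀ {v α} → c (E C′ 0) v ≡ c (E C 0) v → UnsplitCycle v α C → UnsplitCycle v α C′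
    unsplit first-color U = record
      { cycle        = C′-cycle
      ; based        = trans (V-before 0 z≤n) (based U)
      ; leaves       = λ eq → leaves U (trans (sym first-color) eq)
      ; no-base-cusp = λ eq → no-base-cusp U (trans (sym first-color) (trans eq (cong (λ e → c e _) last-edge-unchanged))) }

  module Rotation (C : Walk) (cyc : IsCycle C) (r : ℕ) (0<r : 0 < r) (r<ℓ : r < ℓ C) where
    private
      L₁ = ℓ C ∸ r
      r+L₁≡ℓ : r + L₁ ≡ ℓ C
      r+L₁≡ℓ = m+[n∸m]≡n (<⇒≤ r<ℓ)
      0<L₁ : 0 < L₁
      0<L₁ = m<n⇒0<n∸m r<ℓ
      from-r = segment C r L₁ (≤-reflexive r+L₁≡ℓ)
      to-r   = segment C 0 r (<⇒≤ r<ℓ)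
      glue : V from-r L₁ ≡ V to-r 0
      glue = closed-at cyc r+L₁≡ℓ
      open Concat from-r to-r glue

    rotated : Walk
    rotated = concat from-r to-r glue

    rotated-cycle : IsCycle rotated
    rotated-cycle = record
      { injective = cycleInjective (segment-of-cycle-vertexInjective C cyc r L₁ (≤-reflexive r+L₁≡ℓ) (inj₂ 0<r))
                                   (segment-of-cycle-vertexInjective C cyc 0 r (<⇒≤ r<ℓ) (inj₁ r<ℓ)) meet
      ; closed    = trans (V-right r) (sym (trans (V-left 0 z≤n) (cong (V C) (+-identityʳ r))))
      ; nonempty   = ≤-trans 0<L₁ (m≤m+n L₁ r) }
      where
      meet : ∀ x y → x ≤ L₁ → y ≤ r → V C (r + x) ≡ V C (0 + y) → x ≡ L₁ ⊎ y ≡ r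
      meet x y x≤ y≤ eq with m≤n⇒m<n∨m≡n (subst (r + x ≤_) r+L₁≡ℓ (+-monoʳ-≤ r x≤)) | m≤n⇒m<n∨m≡n y≤
      ... | inj₂ r+x≡ℓ | _ = inj₁ (+-cancelˡ-≡ r x L₁ (trans r+x≡ℓ (sym r+L₁≡ℓ)))
      ... | inj₁ _ | inj₂ y≡r = inj₂ y≡r
      ... | inj₁ r+x<ℓ | inj₁ y<r =
        ⊥-elim (<⇒≢ (<-≤-trans y<r (m≤m+n r x)) (sym (injective cyc (r + x) y r+x<ℓ (<-trans y<r r<ℓ) eq)))

    rotated-start : V rotated 0 ≡ V C r
    rotated-start = trans (V-left 0 z≤n) (cong (V C) (+-identityʳ r))

    rotated-first-edge : E rotated 0 ≡ E C r
    rotated-first-edge = trans (E-left 0 0<L₁) (cong (E C) (+-identityʳ r))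

    rotated-last-edge : E rotated (ℓ rotated ∸ 1) ≡ E C (r ∸ 1)
    rotated-last-edge = trans (cong (E rotated) (+-∸-assoc L₁ 0<r)) (E-right (r ∸ 1))

  module Descent (no-cf-cycle : NoCuspFreeCycle G) (v : Vtx G) (α : Color G)
                 (no-lhd-cusp : ∀ w γ → CuspPoint G w γ → ¬ WalkLhd v α w γ) where

    OnCycle : Vtx G → Walk → Set
    OnCycle x C = ∃ λ i → i < ℓ C × V C i ≡ x

    module Step (N : ℕ) (descent : ∀ C m → UnsplitCycle v α C → CuspFreeBelow C m → ℓ C ≤ m + N → ⊥)
                (C : Walk) (m : ℕ) (U : UnsplitCycle v α C) (fuel : ℓ C ≤ m + suc N)
                (k₀ : ℕ) (j<ℓ : suc k₀ < ℓ C) (cusp₀ : CuspAt C k₀) (m≤j : m ≤ suc k₀)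
                (no-earlier-cusp : CuspFreeBelow C (suc k₀)) where
      j = suc k₀
      w = V C j
      γ = c (E C k₀) w
      cyc = cycle U

      cusp-point : CuspPoint G w γ
      cusp-point =
        E C k₀ , E C j , (k₀≢j , joins-∈ʳ (joins C k₀ (<⇒≤ j<ℓ)) , joins-∈ˡ (joins C j j<ℓ) , cusp₀) , refl
        where
        k₀≢j : E C k₀ ≢ E C j
        k₀≢j eq = 1+n≢n (sym (unsplit-edgeInjective U k₀ j (<⇒≤ j<ℓ) j<ℓ eq))

      before-w = segment C 0 j (<⇒≤ j<ℓ)

      arrow-to-w : WalkArrow v α before-w w γ
      arrow-to-w = record
        { simple     = segment-of-cycle-vertexInjective C cyc 0 j (<⇒≤ j<ℓ) (inj₁ j<ℓ)
        ; cuspFree   = λ k k+1<j cusp → no-earlier-cusp k k+1<j (segment-cusp C 0 j (<⇒≤ j<ℓ) k cusp)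
        ; starts     = based U
        ; ends       = refl
        ; nonempty   = z<s
        ; startColor = leaves U
        ; endColor   = refl }

      module Return {x τ} (q : Walk) (aq : WalkArrow w γ q x τ) (t : ℕ) (t≤ : t ≤ ℓ q) (0<t : 0 < t)
                    (i : ℕ) (i<ℓ : i < ℓ C) (Vi≡Vt : V C i ≡ V q t)
                    (first-return : ∀ s → s < t → ¬ (0 < s × OnCycle (V q s) C)) where
        q′ = segment q 0 t t≤

        q′-simple : VertexInjective q′
        q′-simple = segment-vertexInjective q 0 t t≤ (simple aq)

        q′-cuspFree : CuspFreeWalk q′
        q′-cuspFree = segment-cuspFree q 0 t t≤ (cuspFree aq)

        q′-avoids : ∀ y → 0 < y → y < t → ∀ z → z < ℓ C → V C z ≢ V q y
        q′-avoids y 0<y y<t z z< eq = first-return y y<t (0<y , z , z< , eq)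

        no-cusp-at-w : c (E q 0) w ≢ c (E C k₀) w
        no-cusp-at-w = startColor aq

        forward : j < i → ⊥
        forward j<i = descent C′ (j + t) (unsplit (cong (λ e → c e v) (E-before 0 z<s)) U) cuspFree-below fuel′
          where
          open Bypass C cyc j i j<i i<ℓ q′ q′-simple 0<t (starts aq) (sym Vi≡Vt) q′-avoids
          cuspFree-below : CuspFreeBelow C′ (j + t)
          cuspFree-below k k+1< cusp with bypass-cusp k cusp
          ... | before-a k+1<j cuspC = no-earlier-cusp k k+1<j cuspC
          ... | at-a refl color = no-cusp-at-w (sym color)
          ... | inside-R k′ refl k′+1< cuspR = q′-cuspFree k′ k′+1< cuspR
          ... | at-b refl _ = <-irrefl (trans (sym (+-suc j (t ∸ 1))) (cong (j +_) (suc-∸1 0<t))) k+1<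
          ... | after-b k′ refl _ = n≮n (j + t) (≤-<-trans (m≤m+n (j + t) k′) (<⇒≤ k+1<))
          fuel′ : ℓ C′ ≤ (j + t) + N
          fuel′ = +-monoʳ-≤ (j + t) (m≤n+o⇒m∸n≤o (ℓ C) i (begin
            ℓ C           ≤⟨ fuel ⟩
            m + suc N     ≤⟨ +-monoˡ-≤ (suc N) m≤j ⟩
            j + suc N     ≡⟨ +-suc j N ⟩
            suc j + N     ≤⟨ +-monoˡ-≤ N j<i ⟩
            i + N         ∎))
            where open ≤-Reasoning

        -- The arc of C from i to w, followed by q′, is a cycle whose only possible cusp is at V C i.
        module Loop (i<j : i < j) where
          D = j ∸ i
          i+D≡j : i + D ≡ j
          i+D≡j = m+[n∸m]≡n (<⇒≤ i<j)
          0<D : 0 < D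
          0<D = m<n⇒0<n∸m i<j
          arc-fits : i + D ≤ ℓ C
          arc-fits = subst (_≤ ℓ C) (sym i+D≡j) (<⇒≤ j<ℓ)
          arc = segment C i D arc-fits
          glue : V arc D ≡ V q′ 0
          glue = trans (cong (V C) i+D≡j) (sym (starts aq))
          Z = concat arc q′ glue
          open Concat arc q′ glue

          on-arc : ∀ x → x ≤ D → i + x < ℓ C
          on-arc x x≤ = ≤-<-trans (subst (i + x ≤_) i+D≡j (+-monoʳ-≤ i x≤)) j<ℓ

          meet : ∀ x y → x ≤ D → y ≤ t → V C (i + x) ≡ V q y → x ≡ D ⊎ y ≡ t
          meet x zero x≤ _ eq =
            inj₁ (+-cancelˡ-≡ i x D (trans (injective cyc (i + x) j (on-arc x x≤) j<ℓ (trans eq (starts aq))) (sym i+D≡j)))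
          meet x (suc y) x≤ y≤ eq with m≤n⇒m<n∨m≡n y≤
          ... | inj₁ y< = ⊥-elim (q′-avoids (suc y) z<s y< (i + x) (on-arc x x≤) eq)
          ... | inj₂ y+1≡t = inj₂ y+1≡t

          Z-cycle : IsCycle Z
          Z-cycle = record
            { injective = cycleInjective (segment-of-cycle-vertexInjective C cyc i D arc-fits (inj₁ (on-arc D ≤-refl)))
                                         q′-simple meet
            ; closed    = trans (V-right t) (trans (sym Vi≡Vt) (trans (cong (V C) (sym (+-identityʳ i))) (sym (V-left 0 z≤n))))
            ; nonempty   = ≤-trans 0<D (m≤m+n D t) }

          k₀≡ : ∀ {k} → suc k ≡ D → i + k ≡ k₀
          k₀≡ {k} k+1≡D = suc-injective (trans (sym (+-suc i k)) (trans (cong (i +_) k+1≡D) i+D≡j))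

          first-edge : E Z 0 ≡ E C i
          first-edge = trans (E-left 0 0<D) (cong (E C) (+-identityʳ i))

          Z-edgeInjective : EdgeInjective Z
          Z-edgeInjective = cycle-edgeInjective Z Z-cycle no-digon
            where
            D+t≡2⇒D≡1 : ∀ D t → 0 < D → 0 < t → D + t ≡ 2 → D ≡ 1
            D+t≡2⇒D≡1 (suc zero)    t       _ _ _  = refl
            D+t≡2⇒D≡1 (suc (suc D)) (suc t) _ _ eq = ⊥-elim (m+1+n≢0 D (suc-injective (suc-injective eq)))
            no-digon : ℓ Z ≡ 2 → E Z 0 ≢ E Z 1
            no-digon ℓ≡2 eq = no-cusp-at-w (cong (λ e → c e w) (trans (sym second-edge) (trans (sym eq) first-edge′)))
              where
              D≡1 : D ≡ 1
              D≡1 = D+t≡2⇒D≡1 D t 0<D 0<t ℓ≡2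
              first-edge′ : E Z 0 ≡ E C k₀
              first-edge′ = trans first-edge (cong (E C) (trans (sym (+-identityʳ i)) (k₀≡ (sym D≡1))))
              second-edge : E Z 1 ≡ E q 0
              second-edge = trans (cong (E Z) (sym (trans (+-identityʳ D) D≡1))) (E-right 0)

          Z-cuspFree : CuspFreeWalk Z
          Z-cuspFree k k+1< cusp with <-or-+ D k
          ... | inj₂ (k′ , refl) =
            q′-cuspFree k′ (+-cancelˡ-< D (suc k′) t (subst (_< D + t) (sym (+-suc D k′)) k+1<)) (cusp-right k′ cusp)
          ... | inj₁ k<D with m≤n⇒m<n∨m≡n k<D
          ...   | inj₁ k+1<D = no-earlier-cusp (i + k) (subst (_< j) (+-suc i k) (subst (i + suc k <_) i+D≡j (+-monoʳ-< i k+1<D)))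
                                 (segment-cusp C i D arc-fits k (cusp-left k k+1<D cusp))
          ...   | inj₂ k+1≡D = no-cusp-at-w
                  (sym (subst₂ (λ a b → c (E C a) b ≡ c (E q 0) b) (k₀≡ k+1≡D) (starts aq) (cusp-junction k k+1≡D cusp)))

          base-cusp : c (E q (t ∸ 1)) (V C i) ≡ c (E C i) (V C i)
          base-cusp with c (E q (t ∸ 1)) (V C i) Fin.≟ c (E C i) (V C i)
          ... | yes same = same
          ... | no differ = ⊥-elim (cuspFree-cycle-absurd no-cf-cycle Z Z-cycle Z-edgeInjective Z-cuspFree
                  (λ cusp → differ (trans (sym (cong₂ c last-edge″ base)) (trans cusp (cong₂ c first-edge base)))))
            where
            base : V Z 0 ≡ V C i
            base = trans (V-left 0 z≤n) (cong (V C) (+-identityʳ i))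
            last-edge″ : E Z (ℓ Z ∸ 1) ≡ E q (t ∸ 1)
            last-edge″ = trans (cong (E Z) (+-∸-assoc D 0<t)) (E-right (t ∸ 1))

        backward : i < j → ⊥
        backward i<j = descent C′ (suc (i + t)) (unsplit first-color U) cuspFree-below fuel′
          where
          open Loop i<j using (base-cusp)
          R = reverse q′
          R-avoids : ∀ y → 0 < y → y < t → ∀ z → z < ℓ C → V C z ≢ V R y
          R-avoids y 0<y y<t = q′-avoids (t ∸ y) (m<n⇒0<n∸m y<t) (∸-monoʳ-< {t} {y} {0} 0<y (<⇒≤ y<t))
          open Bypass C cyc i j i<j j<ℓ R (reverse-vertexInjective q′ q′-simple) 0<t
                      (sym Vi≡Vt) (trans (cong (V q) (n∸n≡0 t)) (starts aq)) R-avoids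
          first-color : c (E C′ 0) v ≡ c (E C 0) v
          first-color with m≤n⇒m<n∨m≡n (z≤n {i})
          ... | inj₁ 0<i = cong (λ e → c e v) (E-before 0 0<i)
          ... | inj₂ 0≡i = trans (cong (λ e → c e v) first-edge′) color
            where
            first-edge′ : E C′ 0 ≡ E q (t ∸ 1)
            first-edge′ = trans (cong (E C′) (sym (trans (+-identityʳ i) (sym 0≡i)))) (E-bypass 0 0<t)
            color : c (E q (t ∸ 1)) v ≡ c (E C 0) v
            color = subst (λ x → c (E q (t ∸ 1)) x ≡ c (E C 0) x) (based U)
                       (subst (λ z → c (E q (t ∸ 1)) (V C z) ≡ c (E C z) (V C z)) (sym 0≡i) base-cusp)
          cuspFree-below : CuspFreeBelow C′ (suc (i + t))
          cuspFree-below k k+1< cusp with bypass-cusp k cusp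
          ... | before-a k+1<i cuspC = no-earlier-cusp k (<-trans k+1<i i<j) cuspC
          ... | at-a k+1≡i color = no-earlier-cusp k (subst (_< j) (sym k+1≡i) i<j)
                  (subst (λ z → c (E C k) (V C z) ≡ c (E C z) (V C z)) (sym k+1≡i) (trans color base-cusp))
          ... | inside-R k′ refl k′+1< cuspR = reverse-cuspFree q′ q′-cuspFree k′ k′+1< cuspR
          ... | at-b _ color =
            no-cusp-at-w (trans (subst (λ z → c (E q z) w ≡ c (E C j) w) t∸[1+[t∸1]]≡0 color) (sym cusp₀))
            where
            t∸[1+[t∸1]]≡0 : t ∸ suc (t ∸ 1) ≡ 0
            t∸[1+[t∸1]]≡0 = trans (cong (t ∸_) (suc-∸1 0<t)) (n∸n≡0 t)
          ... | after-b k′ refl _ = n≮n (i + t) (≤-<-trans (m≤m+n (i + t) k′) (s≤s⁻¹ k+1<))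
          fuel′ : ℓ C′ ≤ suc (i + t) + N
          fuel′ = ≤-trans (+-monoʳ-≤ (i + t) (m≤n+o⇒m∸n≤o (ℓ C) j (≤-trans fuel (+-monoˡ-≤ (suc N) m≤j))))
                          (≤-reflexive (+-suc (i + t) N))

        absurd : ⊥
        absurd with <-cmp i j
        ... | tri< i<j _ _ = backward i<j
        ... | tri≈ _ i≡j _ =
          <⇒≢ 0<t (sym (simple aq t 0 t≤ z≤n (trans (sym Vi≡Vt) (trans (cong (V C) i≡j) (sym (starts aq))))))
        ... | tri> _ _ j<i = forward j<i

      unreachable : Unreachable w γ before-w
      unreachable x τ q aq (a , a≤ , Va≡x) with least-below? (λ s → 0 < s × OnCycle (V q s) C) returns? (suc (ℓ q))
        where
        returns? : Decidable (λ s → 0 < s × OnCycle (V q s) C)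
        returns? s = (0 <? s) ×-dec anyUpTo? (λ i → V C i Fin.≟ V q s) (ℓ C)
      ... | inj₂ never = never (ℓ q) ≤-refl (nonempty aq , a , ≤-<-trans a≤ j<ℓ , trans Va≡x (sym (ends aq)))
      ... | inj₁ (t , t< , (0<t , i , i<ℓ , Vi≡Vt) , first) = Return.absurd q aq t (m<1+n⇒m≤n t<) 0<t i i<ℓ Vi≡Vt first

      absurd : ⊥
      absurd = no-lhd-cusp w γ cusp-point (before-w , arrow-to-w , unreachable)

    -- Induction on the fuel N, which bounds the part of C not yet known to be cusp-free.
    descent : ∀ N C m → UnsplitCycle v α C → CuspFreeBelow C m → ℓ C ≤ m + N → ⊥
    descent N C m U cuspFree-below fuel with least-below? (λ k → suc k < ℓ C × CuspAt C k) cusp? (ℓ C)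
      where
      cusp? : Decidable (λ k → suc k < ℓ C × CuspAt C k)
      cusp? k = (suc k <? ℓ C) ×-dec (c (E C k) (V C (suc k)) Fin.≟ c (E C (suc k)) (V C (suc k)))
    ... | inj₂ no-cusp = cuspFree-cycle-absurd no-cf-cycle C (cycle U) (unsplit-edgeInjective U)
                           (λ k k+1< cusp → no-cusp k (<-trans (n<1+n k) k+1<) (k+1< , cusp))
                           (λ cusp → no-base-cusp U (sym (subst (λ z → c (E C (ℓ C ∸ 1)) z ≡ c (E C 0) z) (based U) cusp)))
    ... | inj₁ (k₀ , _ , (j<ℓ , cusp₀) , first) = step N fuel
      where
      m≤j : m ≤ suc k₀
      m≤j = ≮⇒≥ (λ j<m → cuspFree-below k₀ j<m cusp₀)
      no-earlier-cusp : CuspFreeBelow C (suc k₀)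
      no-earlier-cusp k k+1<j cusp = first k (s≤s⁻¹ k+1<j) (<-trans k+1<j j<ℓ , cusp)
      step : ∀ N → ℓ C ≤ m + N → ⊥
      step zero    fuel′ = <-irrefl refl (<-≤-trans j<ℓ (≤-trans fuel′ (≤-trans (≤-reflexive (+-identityʳ m)) m≤j)))
      step (suc N) fuel′ = Step.absurd N (descent N) C m U fuel′ k₀ j<ℓ cusp₀ m≤j no-earlier-cusp

    no-unsplit-cycle : ∀ C → IsCycle C → V C 0 ≡ v → c (E C 0) v ≢ c (E C (ℓ C ∸ 1)) v → ⊥
    no-unsplit-cycle C cyc based′ no-base-cusp′ with c (E C 0) v Fin.≟ α
    ... | no leaves′ = descent (ℓ C) C 1 as-is (λ { k (s≤s ()) }) (n≤1+n (ℓ C))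
      where
      as-is : UnsplitCycle v α C
      as-is = record { cycle = cyc ; based = based′ ; leaves = leaves′ ; no-base-cusp = no-base-cusp′ }
    ... | yes enters = descent (ℓ C) (reverse C) 1 reversed (λ { k (s≤s ()) }) (n≤1+n (ℓ C))
      where
      last-reversed : ℓ C ∸ suc (ℓ C ∸ 1) ≡ 0
      last-reversed = trans (cong (ℓ C ∸_) (suc-∸1 (nonempty cyc))) (n∸n≡0 (ℓ C))
      reversed : UnsplitCycle v α (reverse C)
      reversed = record
        { cycle        = reverse-isCycle C cyc
        ; based        = trans (closed cyc) based′
        ; leaves       = λ eq → no-base-cusp′ (trans enters (sym eq))
        ; no-base-cusp = λ eq → no-base-cusp′ (sym (trans eq (cong (λ z → c (E C z) v) last-reversed))) }

  module _ (P : Vtx G → Color G → Set) (dominates : Dominates G P) (no-cf-cycle : NoCuspFreeCycle G)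
           (v : Vtx G) (α : Color G) (maximal : ∀ u β → P u β → ¬ Lhd G v α u β) where

    no-lhd-cusp : ∀ w γ → CuspPoint G w γ → ¬ WalkLhd v α w γ
    no-lhd-cusp w γ cusp-point lhd with dominates w γ cusp-point
    ... | inj₁ Pw = maximal w γ Pw (walkLhd⇒lhd lhd)
    ... | inj₂ (u , β , Pu , w◁u) = maximal u β Pu (walkLhd⇒lhd (walkLhd-trans lhd (lhd⇒walkLhd w◁u)))

    open Descent no-cf-cycle v α no-lhd-cusp using (no-unsplit-cycle)

    module _ (p : Path G) (cyc : Cycle G p) where
      private
        L = len p
        edge-inj = proj₁ (proj₁ cyc)
        closed′ = proj₁ (proj₂ cyc)
        0<L = proj₂ (proj₂ cyc)
        first = fromℕ< 0<L
        d = es p first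
        C = toWalk p d
        C-cycle = cycle⇒isCycle p d cyc

      base-cusp : V C 0 ≡ v → PathCuspAt G p v
      base-cusp V0≡v with c (E C 0) v Fin.≟ c (E C (L ∸ 1)) v
      ... | no differ = ⊥-elim (no-unsplit-cycle C C-cycle V0≡v differ)
      ... | yes same = closing closed′ first last (toℕ-fromℕ< 0<L) last+1≡L start≡v (last≢first , ∈last , ∈first , color)
        where
        last = fromℕ< (∸1< 0<L)
        last+1≡L : suc (toℕ last) ≡ L
        last+1≡L = trans (cong suc (toℕ-fromℕ< (∸1< 0<L))) (suc-∸1 0<L)
        start≡v : vs p zero ≡ v
        start≡v = trans (sym (toWalk-V p d zero)) V0≡v
        last≢first : es p last ≢ es p first
        last≢first eq = joins-≢ (joins C 0 0<L) (sym (closed-at C-cycle (sym L≡1)))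
          where
          L≡1 : L ≡ 1
          L≡1 = trans (sym last+1≡L) (cong suc (trans (cong toℕ (edge-inj last first eq)) (toℕ-fromℕ< 0<L)))
        ∈last : vs p zero ∈ₑ ψ (es p last)
        ∈last = subst (λ z → z ∈ₑ ψ (es p last))
                  (trans (cong (vs p) (toℕ-injective (trans last+1≡L (sym (toℕ-fromℕ L))))) (sym closed′))
                  (joins-∈ʳ (valid p last))
        ∈first : vs p zero ∈ₑ ψ (es p first)
        ∈first = subst (λ z → vs p z ∈ₑ ψ (es p first)) (toℕ-injective (trans (toℕ-inject₁ first) (toℕ-fromℕ< 0<L)))
                   (joins-∈ˡ (valid p first))
        color : c (es p last) (vs p zero) ≡ c (es p first) (vs p zero)
        color = subst (λ z → c (es p last) z ≡ c (es p first) z) (sym start≡v)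
                   (sym (subst₂ (λ a b → c a v ≡ c b v) (toWalk-E< p d 0 0<L) (toWalk-E< p d (L ∸ 1) (∸1< 0<L)) same))

      visit-cusp : ∀ r → 0 < r → r < L → V C r ≡ v → PathCuspAt G p v
      visit-cusp r 0<r r<L Vr≡v with c (E C r) v Fin.≟ c (E C (r ∸ 1)) v
      ... | no differ = ⊥-elim (no-unsplit-cycle rotated rotated-cycle (trans rotated-start Vr≡v)
                          (subst₂ (λ a b → c a v ≢ c b v) (sym rotated-first-edge) (sym rotated-last-edge) differ))
        where open Rotation C C-cycle r 0<r r<L
      ... | yes same = subst (PathCuspAt G p) vertex≡v (cusp⇒pathCuspAt p edge-inj before after index≡ color)
        where
        r-1<L = ≤-<-trans (m∸n≤m r 1) r<L
        before = fromℕ< r-1<L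
        after = fromℕ< r<L
        index≡ : toℕ after ≡ suc (toℕ before)
        index≡ = trans (toℕ-fromℕ< r<L) (trans (sym (suc-∸1 0<r)) (cong suc (sym (toℕ-fromℕ< r-1<L))))
        vertex≡v : vs p (suc before) ≡ v
        vertex≡v = trans (sym (toWalk-V p d (suc before)))
                     (trans (cong (V C) (trans (cong suc (toℕ-fromℕ< r-1<L)) (suc-∸1 0<r))) Vr≡v)
        color : c (es p before) (vs p (suc before)) ≡ c (es p after) (vs p (suc before))
        color = subst (λ z → c (es p before) z ≡ c (es p after) z) (sym vertex≡v)
                   (sym (subst₂ (λ a b → c a v ≡ c b v) (toWalk-E< p d r r<L) (toWalk-E< p d (r ∸ 1) r-1<L) same))

      cusp-at-v : OccursIn G v p → PathCuspAt G p v
      cusp-at-v (k , vk≡v) = at (toℕ k) (m<1+n⇒m≤n (toℕ<n k)) (trans (toWalk-V p d k) vk≡v)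
        where
        at : ∀ r → r ≤ L → V C r ≡ v → PathCuspAt G p v
        at zero    _      V0≡v = base-cusp V0≡v
        at (suc r) r+1≤L Vr+1≡v with m≤n⇒m<n∨m≡n r+1≤L
        ... | inj₁ r+1<L = visit-cusp (suc r) z<s r+1<L Vr+1≡v
        ... | inj₂ r+1≡L = base-cusp (trans (sym (closed-at C-cycle r+1≡L)) Vr+1≡v)

theorem3p6 : (G : ColGraph) → (P : Vtx G → Color G → Set) →
    Dominates G P → NoCuspFreeCycle G →
    ∀ v α → MaximalIn G P v α → Splitting G v
theorem3p6 G P dominates no-cf-cycle v α (_ , maximal) p cyc v∈p =
  cusp-at-v G P dominates no-cf-cycle v α maximal p cyc v∈p
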